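{- Let $L$ be a diamond with least element $0$ and greatest element $1$, and let $G$ be a finite connected $MH$-homogeneous vertex-uniform $L$-colored graph such that there are no $x,y\in V(G)$ with $\chi(x,y)=1$. Then $G$ is complete, i.e. $\chi(x,y)\neq0$ for all distinct $x,y\in V(G)$.
   Context: A diamond is a poset consisting of a set of pairwise incomparable elements together with a least element $0$ and a greatest element $1$. For a poset $L$ with order $\preceq$, least element $0$ and greatest element $1$: an $L$-colored graph is a triple $G=(V,\chi',\chi'')$ where $V$ is nonempty, $\chi':V\to L$ is arbitrary and $\chi'':V^2\to L$ satisfies $\chi''(x,x)=0$ and $\chi''(x,y)=\chi''(y,x)$. Write $\chi(x)=\chi'(x)$, $\chi(x,y)=\chi''(x,y)$, $V(G)=V$, and $G[W]=(W,\chi'|_W,\chi''|_{W^2})$ for $W\subseteq V$. A homomorphism between $L$-colored graphs is a map $f$ of vertex sets with $\chi_1(x)\preceq\chi_2(f(x))$ and $\chi_1(x,y)\preceq\chi_2(f(x),f(y))$ for all $x,y$; monomorphism = injective homomorphism; endomorphism = homomorphism $G\to G$. $G$ is $MH$-homogeneous if every monomorphism from $G[S]$ to $G[T]$, for finite $S,T\subseteq V$, extends to an endomorphism of $G$. $G$ is vertex-uniform if all vertices have the same color. $G$ is connected if the reflexive transitive closure of $\{(x,y):\chi(x,y)\ne0\}$ is all of $V^2$. -}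

module Defs where

open import Level using (Level)
open import Data.Nat using (ℕ; suc)
open import Data.Fin using (Fin)
open import Data.Fin.Subset using (Subset; _∈_)
open import Data.Product using (Σ; _×_; _,_; proj₁)
open import Relation.Binary.PropositionalEquality using (_≡_; _≢_)
open import Relation.Binary.Construct.Closure.ReflexiveTransitive using (Star)

data Diamond {a : Level} (A : Set a) : Set a where
  𝟘    : Diamond A
  𝟙    : Diamond A
  atom : A → Diamond A

data _≼_ {a : Level} {A : Set a} : Diamond A → Diamond A → Set a where
  0≼    : ∀ {x} → 𝟘 ≼ x
  ≼1    : ∀ {x} → x ≼ 𝟙
  a≼a   : ∀ {p} → atom p ≼ atom p

record ColoredGraph {a : Level} (A : Set a) (n : ℕ) : Set a where
  field
    χv    : Fin n → Diamond A
    χe    : Fin n → Fin n → Diamond A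
    diag  : ∀ x → χe x x ≡ 𝟘
    symm  : ∀ x y → χe x y ≡ χe y x
open ColoredGraph public

module _ {a : Level} {A : Set a} {n : ℕ} (G : ColoredGraph A n) where

  Elt : Subset n → Set
  Elt S = Σ (Fin n) (λ x → x ∈ S)

  IsMono : (S T : Subset n) → (Elt S → Elt T) → Set a
  IsMono S T f =
      (∀ u v → proj₁ (f u) ≡ proj₁ (f v) → proj₁ u ≡ proj₁ v)
    × (∀ u → χv G (proj₁ u) ≼ χv G (proj₁ (f u)))
    × (∀ u v → χe G (proj₁ u) (proj₁ v) ≼ χe G (proj₁ (f u)) (proj₁ (f v)))

  IsEndo : (Fin n → Fin n) → Set a
  IsEndo g = (∀ x → χv G x ≼ χv G (g x)) × (∀ x y → χe G x y ≼ χe G (g x) (g y))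

  MH-homogeneous : Set a
  MH-homogeneous = ∀ (S T : Subset n) (f : Elt S → Elt T) → IsMono S T f →
    Σ (Fin n → Fin n) (λ g → IsEndo g × (∀ u → g (proj₁ u) ≡ proj₁ (f u)))

  VertexUniform : Set a
  VertexUniform = ∀ x y → χv G x ≡ χv G y

  Adj : Fin n → Fin n → Set a
  Adj x y = χe G x y ≢ 𝟘

  Connected : Set a
  Connected = ∀ x y → Star Adj x y

  Complete : Set a
  Complete = ∀ x y → x ≢ y → χe G x y ≢ 𝟘

-- If x and y are distinct and non-adjacent, G contains arbitrarily large cliques, which is
-- absurd in a finite graph. A clique C with a neighbour w outside it grows to a clique
-- containing w: send a vertex p of C adjacent to w onto w by an endomorphism ψ, and extend
-- the map that fixes w and is ψ on the members of C non-adjacent to w to an endomorphism g.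
-- Then g C is a clique all of whose members are adjacent to w = g w. Connectedness provides
-- such a neighbour w as long as C misses x or y, which it must.
module Submission where

open import Defs
open import Level using (Level)
open import Data.Nat using (ℕ; suc)
open import Data.Fin using (Fin; zero; suc; _≟_)
open import Relation.Binary.PropositionalEquality using (_≢_)

open import Data.Nat.Properties using (≤-refl)
open import Data.Fin.Properties using (any?; pigeonhole; <⇒≢)
open import Data.Fin.Subset using (Subset; ⊤) renaming (_∈_ to _∈ₛ_)
open import Data.Fin.Subset.Properties using (∈⊤)
open import Data.Vec using (tabulate)
open import Data.Vec.Properties using ([]=⇒lookup; lookup⇒[]=; lookup∘tabulate)
open import Data.Vec.Functional using (Vector; []; _∷_)
open import Function using (_∘_)
open import Data.Product using (Σ; ∃; ∃₂; _×_; _,_; proj₁; proj₂)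
open import Data.Sum using (_⊎_; inj₁; inj₂; [_,_]′)
open import Relation.Nullary using (¬_; Dec; yes; no; does; contradiction)
open import Relation.Nullary.Decidable using (_⊎-dec_; _×-dec_; dec-true)
open import Relation.Unary using (Pred; Decidable)
open import Relation.Binary using (Rel)
open import Relation.Binary.PropositionalEquality using (_≡_; refl; sym; trans; cong; subst; subst₂)
open import Relation.Binary.Construct.Closure.ReflexiveTransitive using (Star; ε; _◅_)

module _ {a : Level} {A : Set a} where

  _≟𝟘 : (d : Diamond A) → Dec (d ≡ 𝟘)
  𝟘 ≟𝟘      = yes refl
  𝟙 ≟𝟘      = no λ ()
  atom _ ≟𝟘 = no λ ()

  ≼-refl : {d : Diamond A} → d ≼ d
  ≼-refl {𝟘}      = 0≼
  ≼-refl {𝟙}      = ≼1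
  ≼-refl {atom _} = a≼a

  ≼-resp-≢𝟘 : {d e : Diamond A} → d ≼ e → d ≢ 𝟘 → e ≢ 𝟘
  ≼-resp-≢𝟘 0≼  d≢𝟘 = contradiction refl d≢𝟘
  ≼-resp-≢𝟘 ≼1  _   = λ ()
  ≼-resp-≢𝟘 a≼a _   = λ ()

  ≡𝟘⇒≼ : {d : Diamond A} (e : Diamond A) → d ≡ 𝟘 → d ≼ e
  ≡𝟘⇒≼ _ refl = 0≼

module _ {ℓ₁ ℓ₂ ℓ₃ : Level} {X : Set ℓ₁} {R : Rel X ℓ₂} {Q : Pred X ℓ₃} (Q? : Decidable Q) where

  Star-leaves : ∀ {s t} → Star R s t → Q s → ¬ Q t → ∃₂ λ u v → R u v × Q u × ¬ Q v
  Star-leaves ε                     Qs ¬Qt = contradiction Qs ¬Qt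
  Star-leaves (_◅_ {j = v} Rsv v⇝t) Qs ¬Qt with Q? v
  ... | yes Qv = Star-leaves v⇝t Qv ¬Qt
  ... | no ¬Qv = _ , v , Rsv , Qs , ¬Qv

module _ {n : ℕ} {ℓ : Level} {P : Pred (Fin n) ℓ} (P? : Decidable P) where

  subsetOf : Subset n
  subsetOf = tabulate (λ x → does (P? x))

  ∈-subsetOf⁺ : ∀ {x} → P x → x ∈ₛ subsetOf
  ∈-subsetOf⁺ {x} Px = lookup⇒[]= x subsetOf (trans (lookup∘tabulate _ x) (dec-true (P? x) Px))

  ∈-subsetOf⁻ : ∀ {x} → x ∈ₛ subsetOf → P x
  ∈-subsetOf⁻ {x} x∈ with P? x | trans (sym (lookup∘tabulate _ x)) ([]=⇒lookup x∈)
  ... | yes Px | _  = Px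
  ... | no _   | ()

module _ {a : Level} {A : Set a} {n : ℕ} (G : ColoredGraph A n) where

  Adj-sym : ∀ {x y} → Adj G x y → Adj G y x
  Adj-sym {x} {y} xy yx≡𝟘 = xy (trans (symm G x y) yx≡𝟘)

  Adj-irrefl : ∀ {x y} → Adj G x y → x ≢ y
  Adj-irrefl {x} xx refl = xx (diag G x)

  IsEndo⇒Adj : ∀ {g} → IsEndo G g → ∀ {x y} → Adj G x y → Adj G (g x) (g y)
  IsEndo⇒Adj (_ , mono) {x} {y} = ≼-resp-≢𝟘 (mono x y)

  Clique : ∀ {k} → Vector (Fin n) k → Set a
  Clique c = ∀ i j → i ≢ j → Adj G (c i) (c j)

  Clique-∷ : ∀ {k w} {c : Vector (Fin n) k} → Clique c → (∀ i → Adj G w (c i)) → Clique (w ∷ c)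
  Clique-∷ _  w~c zero    zero    0≢0 = contradiction refl 0≢0
  Clique-∷ _  w~c zero    (suc j) _   = w~c j
  Clique-∷ _  w~c (suc i) zero    _   = Adj-sym (w~c i)
  Clique-∷ cl _   (suc i) (suc j) i≢j = cl i j (λ i≡j → i≢j (cong suc i≡j))

  InImage : ∀ {k} → Vector (Fin n) k → Pred (Fin n) _
  InImage c x = ∃ λ i → c i ≡ x

  inImage? : ∀ {k} (c : Vector (Fin n) k) → Decidable (InImage c)
  inImage? c x = any? (λ i → c i ≟ x)

  Clique-misses-non-adjacent : ∀ {k x y} {c : Vector (Fin n) k} → Clique c → x ≢ y → χe G x y ≡ 𝟘 →
    ¬ InImage c x ⊎ ¬ InImage c y
  Clique-misses-non-adjacent {x = x} {y} {c} cl x≢y xy≡𝟘 with inImage? c x | inImage? c y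
  ... | no ¬x          | _              = inj₁ ¬x
  ... | yes _          | no ¬y          = inj₂ ¬y
  ... | yes (i , refl) | yes (j , refl) with i ≟ j
  ...   | yes refl = contradiction refl x≢y
  ...   | no i≢j   = contradiction xy≡𝟘 (cl i j i≢j)

  no-oversized-clique : (c : Vector (Fin n) (suc n)) → ¬ Clique c
  no-oversized-clique c cl with pigeonhole ≤-refl c
  ... | i , j , i<j , cᵢ≡cⱼ = Adj-irrefl (cl i j (<⇒≢ i<j)) cᵢ≡cⱼ

module _ {a : Level} {A : Set a} {n : ℕ} (G : ColoredGraph A n)
         (mh : MH-homogeneous G) (vu : VertexUniform G) where

  extend-on : ∀ {ℓ} {P : Pred (Fin n) ℓ} → Decidable P → (h : Fin n → Fin n) →
    (∀ {x y} → P x → P y → h x ≡ h y → x ≡ y) →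
    (∀ {x y} → P x → P y → χe G x y ≼ χe G (h x) (h y)) →
    ∃ λ g → IsEndo G g × (∀ {x} → P x → g x ≡ h x)
  extend-on P? h inj mono with mh (subsetOf P?) ⊤ (λ (x , _) → h x , ∈⊤)
    ( (λ (_ , x∈) (_ , y∈) → inj (∈-subsetOf⁻ P? x∈) (∈-subsetOf⁻ P? y∈))
    , (λ (x , _) → subst (χv G x ≼_) (vu x (h x)) ≼-refl)
    , (λ (_ , x∈) (_ , y∈) → mono (∈-subsetOf⁻ P? x∈) (∈-subsetOf⁻ P? y∈)) )
  ... | g , g-endo , g≗h = g , g-endo , λ Px → g≗h (_ , ∈-subsetOf⁺ P? Px)

  endo-sending : ∀ p w → ∃ λ g → IsEndo G g × g p ≡ w
  endo-sending p w with extend-on (_≟ p) (λ _ → w) (λ { refl refl _ → refl }) (λ { refl refl → ≡𝟘⇒≼ _ (diag G p) })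
  ... | g , g-endo , g≗w = g , g-endo , g≗w refl

  module Absorption {k : ℕ} {c : Vector (Fin n) k} (cl : Clique G c) {w : Fin n} (w∉c : ∀ i → c i ≢ w)
                    {i₀ : Fin k} (w~cᵢ₀ : Adj G w (c i₀)) where

    ψ : Fin n → Fin n
    ψ = proj₁ (endo-sending (c i₀) w)

    ψ-endo : IsEndo G ψ
    ψ-endo = proj₁ (proj₂ (endo-sending (c i₀) w))

    ψcᵢ₀≡w : ψ (c i₀) ≡ w
    ψcᵢ₀≡w = proj₂ (proj₂ (endo-sending (c i₀) w))

    NonNeighbour : Pred (Fin n) a
    NonNeighbour x = InImage G c x × χe G w x ≡ 𝟘

    NonNeighbour⇒≢w : ∀ {x} → NonNeighbour x → x ≢ w
    NonNeighbour⇒≢w ((i , refl) , _) = w∉c i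

    ψ-NonNeighbour : ∀ {x} → NonNeighbour x → Adj G w (ψ x)
    ψ-NonNeighbour ((i , refl) , w≁cᵢ) =
      subst (λ v → Adj G v (ψ (c i))) ψcᵢ₀≡w (IsEndo⇒Adj G ψ-endo (cl i₀ i λ { refl → w~cᵢ₀ w≁cᵢ }))

    h : Fin n → Fin n
    h x with x ≟ w
    ... | yes _ = w
    ... | no  _ = ψ x

    h-w : h w ≡ w
    h-w with w ≟ w
    ... | yes _   = refl
    ... | no  w≢w = contradiction refl w≢w

    h-≢w : ∀ {x} → x ≢ w → h x ≡ ψ x
    h-≢w {x} x≢w with x ≟ w
    ... | yes x≡w = contradiction x≡w x≢w
    ... | no  _   = refl

    h-NonNeighbour : ∀ {x} → NonNeighbour x → Adj G w (h x)
    h-NonNeighbour s = subst (Adj G w) (sym (h-≢w (NonNeighbour⇒≢w s))) (ψ-NonNeighbour s)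

    Domain : Pred (Fin n) a
    Domain x = x ≡ w ⊎ NonNeighbour x

    domain? : Decidable Domain
    domain? x = (x ≟ w) ⊎-dec (inImage? G c x ×-dec (χe G w x ≟𝟘))

    h-injective : ∀ {x y} → Domain x → Domain y → h x ≡ h y → x ≡ y
    h-injective (inj₁ refl) (inj₁ refl) _   = refl
    h-injective (inj₁ refl) (inj₂ s)    eq  =
      contradiction (trans (sym h-w) eq) (Adj-irrefl G (h-NonNeighbour s))
    h-injective (inj₂ s)    (inj₁ refl) eq  =
      contradiction (trans (sym h-w) (sym eq)) (Adj-irrefl G (h-NonNeighbour s))
    h-injective (inj₂ sᵢ@((i , refl) , _)) (inj₂ sⱼ@((j , refl) , _)) eq with i ≟ j
    ... | yes refl = refl
    ... | no  i≢j  = contradiction (trans (sym (h-≢w (NonNeighbour⇒≢w sᵢ))) (trans eq (h-≢w (NonNeighbour⇒≢w sⱼ))))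
                                   (Adj-irrefl G (IsEndo⇒Adj G ψ-endo (cl i j i≢j)))

    h-monotone : ∀ {x y} → Domain x → Domain y → χe G x y ≼ χe G (h x) (h y)
    h-monotone (inj₁ refl) (inj₁ refl)       = ≡𝟘⇒≼ _ (diag G w)
    h-monotone (inj₁ refl) (inj₂ (_ , w≁y))  = ≡𝟘⇒≼ _ w≁y
    h-monotone {x} (inj₂ (_ , w≁x)) (inj₁ refl) = ≡𝟘⇒≼ _ (trans (symm G x w) w≁x)
    h-monotone {x} {y} (inj₂ sx) (inj₂ sy) =
      subst₂ (λ u v → χe G x y ≼ χe G u v) (sym (h-≢w (NonNeighbour⇒≢w sx))) (sym (h-≢w (NonNeighbour⇒≢w sy)))
             (proj₂ ψ-endo x y)

    g : Fin n → Fin n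
    g = proj₁ (extend-on domain? h h-injective h-monotone)

    g-endo : IsEndo G g
    g-endo = proj₁ (proj₂ (extend-on domain? h h-injective h-monotone))

    g≗h : ∀ {x} → Domain x → g x ≡ h x
    g≗h = proj₂ (proj₂ (extend-on domain? h h-injective h-monotone))

    w~gc : ∀ i → Adj G w (g (c i))
    w~gc i with χe G w (c i) ≟𝟘
    ... | yes w≁cᵢ = subst (Adj G w) (sym (g≗h (inj₂ ((i , refl) , w≁cᵢ)))) (h-NonNeighbour ((i , refl) , w≁cᵢ))
    ... | no  w~cᵢ = subst (λ v → Adj G v (g (c i))) (trans (g≗h (inj₁ refl)) h-w) (IsEndo⇒Adj G g-endo w~cᵢ)

  Clique-absorb : ∀ {k w} {c : Vector (Fin n) k} → Clique G c → (∀ i → c i ≢ w) → ∀ {i₀} → Adj G w (c i₀) →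
    ∃ λ c′ → Clique G c′ × (∀ i → Adj G w (c′ i))
  Clique-absorb cl w∉c w~cᵢ₀ = g ∘ _ , (λ i j i≢j → IsEndo⇒Adj G g-endo (cl i j i≢j)) , w~gc
    where open Absorption cl w∉c w~cᵢ₀

  Clique-grow : Connected G → ∀ {k t} {c : Vector (Fin n) (suc k)} → Clique G c → ¬ InImage G c t →
    Σ (Vector (Fin n) (suc (suc k))) (Clique G)
  Clique-grow conn {c = c} cl t∉c with Star-leaves (inImage? G c) (conn (c zero) _) (zero , refl) t∉c
  ... | _ , w , u~w , (_ , refl) , w∉c with Clique-absorb cl (λ j cⱼ≡w → w∉c (j , cⱼ≡w)) (Adj-sym G u~w)
  ...   | c′ , cl′ , w~c′ = w ∷ c′ , Clique-∷ G cl′ w~c′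

mainTheorem9 : {a : Level} (A : Set a) (n : ℕ) (G : ColoredGraph A (suc n)) →
    Connected G → MH-homogeneous G → VertexUniform G →
    (∀ x y → χe G x y ≢ 𝟙) →
    Complete G
mainTheorem9 A n G conn mh vu _ x y x≢y xy≡𝟘 = let c , cl = cliques (suc n) in no-oversized-clique G c cl
  where
  cliques : ∀ k → Σ (Vector (Fin (suc n)) (suc k)) (Clique G)
  cliques 0       = x ∷ [] , Clique-∷ G (λ ()) (λ ())
  cliques (suc k) = let c , cl = cliques k in
    [ Clique-grow G mh vu conn cl , Clique-grow G mh vu conn cl ]′
      (Clique-misses-non-adjacent G cl x≢y xy≡𝟘)
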